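{- Let $\mathcal{S}$ be a set of $\{0,1\}$-valued sequences such that (i) every sequence in $\mathcal{S}$ converges, and (ii) whenever $\{\bar a^i\}_{i\in\mathbb{N}}\subseteq\mathcal{S}$, every limit sequence of $(\bar a^i)_{i\in\mathbb{N}}$ is also in $\mathcal{S}$. Then $\mathcal{S}$ converges uniformly metastably.
   Context: A sequence is $\bar a=(a_n)_{n\in\mathbb{N}}$ with $a_n\in\{0,1\}$. It converges if there are $m$ and $c\in\{0,1\}$ with $a_n=c$ for all $n\ge m$. Given sequences $\bar a^i$ ($i\in\mathbb{N}$), a limit sequence is a sequence $\bar b$ for which there is an infinite set $S\subseteq\mathbb{N}$ such that for each $n$, $\{i\in S: a^i_n\neq b_n\}$ is finite. $\mathcal{S}$ converges uniformly metastably if for every $F:\mathbb{N}\to\mathbb{N}$ there is $M_F$ such that for every $\bar a\in\mathcal{S}$ there are $m\le M_F$ and $c\in\{0,1\}$ with $a_n=c$ for all $n\in[m,F(m)]$. -}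

module Defs where

open import Data.Nat using (ℕ; _≤_; _<_)
open import Data.Bool using (Bool)
open import Data.Product using (∃-syntax; _×_)
open import Relation.Binary.PropositionalEquality using (_≡_; _≢_)

-- A {0,1}-valued sequence (0 ↦ false, 1 ↦ true).
Seq : Set
Seq = ℕ → Bool

Converges : Seq → Set
Converges a = ∃[ m ] ∃[ c ] (∀ n → m ≤ n → a n ≡ c)

Infinite : (ℕ → Set) → Set
Infinite X = ∀ k → ∃[ i ] (k ≤ i × X i)

Finite : (ℕ → Set) → Set
Finite X = ∃[ N ] (∀ i → X i → i < N)

IsLimitSequence : (ℕ → Seq) → Seq → Set₁
IsLimitSequence as b =
  ∃[ S ] (Infinite S × (∀ n → Finite (λ i → S i × (as i n ≢ b n))))

UniformlyMetastable : (Seq → Set) → Set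
UniformlyMetastable 𝒮 =
  ∀ (F : ℕ → ℕ) → ∃[ M ] (∀ a → 𝒮 a →
    ∃[ m ] (m ≤ M × ∃[ c ] (∀ n → m ≤ n → n ≤ F m → a n ≡ c)))

-- Under excluded middle, every sequence of {0,1}-sequences has a limit sequence: König's
-- lemma picks, bit by bit, a branch followed by infinitely many of the sequences, and a
-- diagonal choice of indices witnesses the limit. If 𝒮 were not uniformly metastable for
-- some F, then for every bound M some aᴹ ∈ 𝒮 would fail to be F-stable below M. A limit
-- sequence b of these lies in 𝒮, so it converges, say to c from m on. Infinitely many aᴹ
-- agree with b on [0, F m]; any such aᴹ with M ≥ m is constant on [m, F m], a contradiction.
module Submission where

open import Defs
open import Level using (0ℓ)
open import Axiom.ExcludedMiddle using (ExcludedMiddle)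
open import Axiom.DoubleNegationElimination using (em⇒dne)
open import Data.Nat using (ℕ; zero; suc; _≤_; _<_; _≤′_; ≤′-refl; ≤′-step; _⊔_; s≤s)
open import Data.Nat.Properties
  using (≤-refl; ≤-trans; <⇒≤; <⇒≱; ≰⇒>; ≤⇒≤′; m<1+n⇒m<n∨m≡n; _≤?_
        ; m≤m⊔n; m≤n⊔m; m⊔n≤o⇒m≤o; m⊔n≤o⇒n≤o)
open import Data.Bool using (Bool; true; false)
open import Data.Bool.Properties using (_≟_)
open import Data.Unit using (⊤; tt)
open import Data.Empty using (⊥)
open import Data.Product using (∃-syntax; _×_; _,_; proj₁; proj₂)
open import Data.Sum using (inj₁; inj₂)
open import Relation.Nullary using (¬_; yes; no; does; contradiction)
open import Relation.Binary.PropositionalEquality using (_≡_; refl; trans)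

finite-family-bound : {X : ℕ → ℕ → Set} → (∀ n → Finite (X n)) →
  ∀ k → ∃[ N ] (∀ n → n < k → ∀ i → X n i → i < N)
finite-family-bound fin zero = 0 , λ _ ()
finite-family-bound {X} fin (suc k) with finite-family-bound fin k | fin k
... | N , below | Nₖ , belowₖ = N ⊔ Nₖ , below-max
  where
  below-max : ∀ n → n < suc k → ∀ i → X n i → i < N ⊔ Nₖ
  below-max n n<1+k i x with m<1+n⇒m<n∨m≡n n<1+k
  ... | inj₁ n<k = ≤-trans (below n n<k i x) (m≤m⊔n N Nₖ)
  ... | inj₂ refl = ≤-trans (belowₖ i x) (m≤n⊔m N Nₖ)

limitSequence-agreesOnPrefix : ∀ {as b} → IsLimitSequence as b →
  ∀ k l → ∃[ i ] (l ≤ i × (∀ n → n < k → as i n ≡ b n))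
limitSequence-agreesOnPrefix {as} {b} (S , S-infinite , exceptions-finite) k l
  with finite-family-bound exceptions-finite k
... | N , below with S-infinite (N ⊔ l)
... | i , N⊔l≤i , i∈S = i , m⊔n≤o⇒n≤o N l N⊔l≤i , agree
  where
  agree : ∀ n → n < k → as i n ≡ b n
  agree n n<k with as i n ≟ b n
  ... | yes eq = eq
  ... | no neq = contradiction (m⊔n≤o⇒m≤o N l N⊔l≤i) (<⇒≱ (below n n<k i (i∈S , neq)))

module _ (em : ExcludedMiddle 0ℓ) where

  private
    dne : {P : Set} → ¬ ¬ P → P
    dne = em⇒dne em

  ¬∃∀⇒∀∃¬ : {A B : Set} {P : A → Set} {Q : A → B → Set} →
    ¬ (∃[ y ] (∀ x → P x → Q x y)) → ∀ y → ∃[ x ] (P x × ¬ Q x y)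
  ¬∃∀⇒∀∃¬ ¬bounded y =
    dne λ none → ¬bounded (y , λ x p → dne λ ¬q → none (x , p , ¬q))

  infinite-split : (X : ℕ → Set) (p : ℕ → Bool) → Infinite X →
    ¬ Infinite (λ i → X i × p i ≡ true) → Infinite (λ i → X i × p i ≡ false)
  infinite-split X p X-infinite ¬true-infinite k =
    dne λ none → ¬true-infinite (true-above none)
    where
    true-above : ¬ (∃[ i ] (k ≤ i × (X i × p i ≡ false))) →
      ∀ k′ → ∃[ i ] (k′ ≤ i × (X i × p i ≡ true))
    true-above none k′ with X-infinite (k ⊔ k′)
    ... | i , k⊔k′≤i , x with p i in eq
    ... | true = i , m⊔n≤o⇒n≤o k k′ k⊔k′≤i , x , eq
    ... | false = contradiction (i , m⊔n≤o⇒m≤o k k′ k⊔k′≤i , x , eq) none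

  module KönigBranch (as : ℕ → Seq) where

    mutual
      Follows : ℕ → ℕ → Set
      Follows zero i = ⊤
      Follows (suc n) i = Follows n i × as i n ≡ branch n

      branch : Seq
      branch n = does (em {Infinite (λ i → Follows n i × as i n ≡ true)})

    follows-infinite : ∀ n → Infinite (Follows n)
    follows-infinite zero k = k , ≤-refl , tt
    follows-infinite (suc n) with em {Infinite (λ i → Follows n i × as i n ≡ true)}
    ... | yes true-infinite = true-infinite
    ... | no ¬true-infinite =
      infinite-split (Follows n) (λ i → as i n) (follows-infinite n) ¬true-infinite

    follows⇒agrees : ∀ {k i} → Follows k i → ∀ n → n < k → as i n ≡ branch n
    follows⇒agrees {suc k} (follows , eq) n n<1+k with m<1+n⇒m<n∨m≡n n<1+k
    ... | inj₁ n<k = follows⇒agrees follows n n<k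
    ... | inj₂ refl = eq

    pick : ℕ → ℕ
    pick zero = 0
    pick (suc k) = proj₁ (follows-infinite (suc k) (suc (pick k)))

    pick-follows : ∀ k → Follows k (pick k)
    pick-follows zero = tt
    pick-follows (suc k) = proj₂ (proj₂ (follows-infinite (suc k) (suc (pick k))))

    pick-increasing : ∀ k → pick k < pick (suc k)
    pick-increasing k = proj₁ (proj₂ (follows-infinite (suc k) (suc (pick k))))

    pick-monotone : ∀ {k n} → k ≤′ n → pick k ≤ pick n
    pick-monotone ≤′-refl = ≤-refl
    pick-monotone (≤′-step k≤′n) = ≤-trans (pick-monotone k≤′n) (<⇒≤ (pick-increasing _))

    n≤pick : ∀ n → n ≤ pick n
    n≤pick zero = ≤-refl
    n≤pick (suc n) = ≤-trans (s≤s (n≤pick n)) (pick-increasing n)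

    branch-isLimitSequence : IsLimitSequence as branch
    branch-isLimitSequence = Picked , (λ k → pick k , n≤pick k , k , refl) , exceptions-finite
      where
      Picked : ℕ → Set
      Picked i = ∃[ k ] (pick k ≡ i)

      exceptions-finite : ∀ n → Finite (λ i → Picked i × ¬ as i n ≡ branch n)
      exceptions-finite n = suc (pick n) , below
        where
        below : ∀ i → Picked i × ¬ as i n ≡ branch n → i < suc (pick n)
        below .(pick k) ((k , refl) , differs) with k ≤? n
        ... | yes k≤n = s≤s (pick-monotone (≤⇒≤′ k≤n))
        ... | no k≰n = contradiction (follows⇒agrees (pick-follows k) n (≰⇒> k≰n)) differs

  limitSequence-exists : (as : ℕ → Seq) → ∃[ b ] IsLimitSequence as b
  limitSequence-exists as = branch , branch-isLimitSequence
    where open KönigBranch as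

MetastableBelow : (ℕ → ℕ) → ℕ → Seq → Set
MetastableBelow F M a = ∃[ m ] (m ≤ M × ∃[ c ] (∀ n → m ≤ n → n ≤ F m → a n ≡ c))

mainTheorem3 : ExcludedMiddle 0ℓ → ExcludedMiddle (Level.suc 0ℓ) →
    (𝒮 : Seq → Set) →
    (∀ a → 𝒮 a → Converges a) →
    (∀ (as : ℕ → Seq) → (∀ i → 𝒮 (as i)) → ∀ b → IsLimitSequence as b → 𝒮 b) →
    UniformlyMetastable 𝒮
mainTheorem3 em _ 𝒮 converges closed F =
  em⇒dne em λ ¬bounded → refute (¬∃∀⇒∀∃¬ em ¬bounded)
  where
  refute : (∀ M → ∃[ a ] (𝒮 a × ¬ MetastableBelow F M a)) → ⊥
  refute counterexample with limitSequence-exists em (λ M → proj₁ (counterexample M))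
  ... | b , b-limit with converges b (closed _ (λ M → proj₁ (proj₂ (counterexample M))) b b-limit)
  ... | m , c , b-constant with limitSequence-agreesOnPrefix b-limit (suc (F m)) m
  ... | M , m≤M , agree = proj₂ (proj₂ (counterexample M))
    (m , m≤M , c , λ n m≤n n≤Fm → trans (agree n (s≤s n≤Fm)) (b-constant n m≤n))
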